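{- Let $M$ be a finite abelian group of order $m$ and $J$ a Jacobi function on $M$, and suppose there is a bijection $i\colon\hat{M}\to\hat{M}$ with $i(x)=x\,i(x^{ -1})$ for all $x\in\hat{M}$ and $J(\alpha,\beta)=\frac{1}{m}\sum_{x\in\hat{M}}\alpha(i(x))\beta(i(x)x^{ -1})$ for all $\alpha,\beta\in M$. Define $\oplus$ on $\hat{M}$ by $x\oplus y=x\,i(x/y)^{ -1}$. Then $\oplus$ is associative.
   Context: $\hat{M}$ is the Pontryagin dual of $M$ (written multiplicatively, identity $1$), and $\alpha(x)$ is the pairing of $\alpha\in M$ with $x\in\hat{M}$. $\delta(\alpha)=1$ if $\alpha$ is the identity of $M$, else $0$. A Jacobi function on $M$ is a function $J \colon M\times M \to \mathbf{C}$ satisfying: (A) $J(\alpha,\beta)=J(\beta,\alpha)$; (B) with $J^*(\alpha,\beta)=J(\alpha,\beta)-\delta(\alpha)-\delta(\beta)$, $J^*(\alpha,\beta)J^*(\alpha\beta,\gamma)=J^*(\alpha,\beta\gamma)J^*(\beta,\gamma)$ for all $\alpha,\beta,\gamma$; (C) $\sum_{\beta\in M} J(\alpha_1\beta,\alpha_2\beta^{ -1})J(\alpha_3\beta,\alpha_4\beta^{ -1}) = J(\alpha_1\alpha_4,\alpha_2\alpha_3)$ for all $\alpha_1,\dots,\alpha_4 \in M$. -}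

module Defs where

open import Level using (Level; _⊔_) renaming (suc to lsuc)
open import Algebra.Core using (Op₁; Op₂)
open import Algebra.Structures using (IsAbelianGroup)
open import Algebra.Bundles using (CommutativeRing; AbelianGroup; Group)
import Algebra.Properties.CommutativeSemigroup as CSProps
import Algebra.Properties.AbelianGroup as AGProps
import Algebra.Properties.Group as GProps
open import Data.Nat using (ℕ; zero; suc)
open import Data.List using (List; []; _∷_; [_]; _++_; map; foldr; length)
open import Data.List.Membership.Propositional using (_∈_)
import Data.List.Membership.Setoid as SetoidMembership
import Data.List.Relation.Unary.Unique.Propositional as UniqueP
import Data.List.Relation.Unary.Unique.Setoid as UniqueS
open import Data.Product using (∃; _×_; _,_)
open import Relation.Nullary using (¬_)
open import Relation.Nullary.Decidable using (⌊_⌋)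
open import Data.Bool using (if_then_else_)
open import Relation.Binary.Bundles using (Setoid)
open import Relation.Binary.Definitions using (DecidableEquality)
open import Relation.Binary.PropositionalEquality using (_≡_; refl)
import Relation.Binary.PropositionalEquality as Eq
import Relation.Binary.Reasoning.Setoid as SetoidReasoning
open import Function.Bundles using (Bijection)

record FiniteAbelianGroup : Set₁ where
  field
    Carrier        : Set
    _∙_            : Op₂ Carrier
    ε              : Carrier
    _⁻¹            : Op₁ Carrier
    isAbelianGroup : IsAbelianGroup _≡_ _∙_ ε _⁻¹
    _≟_            : DecidableEquality Carrier
    elements       : List Carrier
    complete       : ∀ a → a ∈ elements
    distinct       : UniqueP.Unique elements

  open IsAbelianGroup isAbelianGroup public

  abelianGroup : AbelianGroup Level.zero Level.zero
  abelianGroup = record { isAbelianGroup = isAbelianGroup }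

  group : Group Level.zero Level.zero
  group = AbelianGroup.group abelianGroup

  order : ℕ
  order = length elements

module RingUtils {c ℓ : Level} (R : CommutativeRing c ℓ) where
  open CommutativeRing R

  fromℕ : ℕ → Carrier
  fromℕ zero    = 0#
  fromℕ (suc n) = 1# + fromℕ n

  sumL : List Carrier → Carrier
  sumL = foldr _+_ 0#

  eval : List Carrier → Carrier → Carrier
  eval []       r = 0#
  eval (c ∷ cs) r = c + r * eval cs r

-- Algebraically closed fields of characteristic zero (stand-in for ℂ).

record ACF0 (c ℓ : Level) : Set (lsuc (c ⊔ ℓ)) where
  field
    commutativeRing : CommutativeRing c ℓ
  open CommutativeRing commutativeRing public
  open RingUtils commutativeRing public
  field
    1≉0        : ¬ (1# ≈ 0#)
    inverse    : ∀ x → ¬ (x ≈ 0#) → ∃ λ y → x * y ≈ 1#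
    char0      : ∀ n → ¬ (fromℕ (suc n) ≈ 0#)
    -- every monic polynomial  c₀ + c₁ X + … + cₙ₋₁ Xⁿ⁻¹ + Xⁿ  (n ≥ 1) has a root
    algClosed  : ∀ c₀ cs → ∃ λ r → eval (c₀ ∷ cs ++ [ 1# ]) r ≈ 0#

module Dual {c ℓ : Level} (M : FiniteAbelianGroup) (K : ACF0 c ℓ) where
  private
    module M = FiniteAbelianGroup M
    module K = ACF0 K
  open K using (_≈_; _*_; _+_; _-_; 0#; 1#)

  record Character : Set (c ⊔ ℓ) where
    field
      χ    : M.Carrier → K.Carrier
      hom  : ∀ a b → χ (a M.∙ b) ≈ χ a * χ b
      unit : χ M.ε ≈ 1#
  open Character public

  _≈ᶜ_ : Character → Character → Set ℓ
  x ≈ᶜ y = ∀ a → χ x a ≈ χ y a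

  CharSetoid : Setoid (c ⊔ ℓ) ℓ
  CharSetoid = record
    { Carrier = Character
    ; _≈_ = _≈ᶜ_
    ; isEquivalence = record
      { refl  = λ a → K.refl
      ; sym   = λ p a → K.sym (p a)
      ; trans = λ p q a → K.trans (p a) (q a) } }

  ⟨_,_⟩ : M.Carrier → Character → K.Carrier
  ⟨ α , x ⟩ = χ x α

  _·_ : Character → Character → Character
  x · y = record
    { χ    = λ a → χ x a * χ y a
    ; hom  = λ a b → K.trans (K.*-cong (hom x a b) (hom y a b))
                       (CSProps.interchange K.*-commutativeSemigroup _ _ _ _)
    ; unit = K.trans (K.*-cong (unit x) (unit y)) (K.*-identityˡ 1#) }

  _⁻¹ᶜ : Character → Character
  x ⁻¹ᶜ = record
    { χ    = λ a → χ x (a M.⁻¹)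
    ; hom  = λ a b → hom′ a b
    ; unit = unit′ }
    where
      open SetoidReasoning K.setoid
      hom′ : ∀ a b → χ x ((a M.∙ b) M.⁻¹) ≈ χ x (a M.⁻¹) * χ x (b M.⁻¹)
      hom′ a b rewrite Eq.sym (AGProps.⁻¹-∙-comm M.abelianGroup a b) = hom x (a M.⁻¹) (b M.⁻¹)
      unit′ : χ x (M.ε M.⁻¹) ≈ 1#
      unit′ rewrite GProps.ε⁻¹≈ε M.group = unit x

  _/_ : Character → Character → Character
  x / y = x · (y ⁻¹ᶜ)

  record DualEnumeration : Set (c ⊔ ℓ) where
    field
      characters : List Character
      complete   : ∀ x → SetoidMembership._∈_ CharSetoid x characters
      distinct   : UniqueS.Unique CharSetoid characters

  ΣM : (M.Carrier → K.Carrier) → K.Carrier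
  ΣM f = K.sumL (map f M.elements)

  ΣM̂ : DualEnumeration → (Character → K.Carrier) → K.Carrier
  ΣM̂ D f = K.sumL (map f (DualEnumeration.characters D))

  δ : M.Carrier → K.Carrier
  δ α = if ⌊ α M.≟ M.ε ⌋ then 1# else 0#

  record IsJacobi (J : M.Carrier → M.Carrier → K.Carrier) : Set ℓ where
    J* : M.Carrier → M.Carrier → K.Carrier
    J* α β = J α β - δ α - δ β
    field
      symmetric : ∀ α β → J α β ≈ J β α
      cocycle   : ∀ α β γ →
                  J* α β * J* (α M.∙ β) γ ≈ J* α (β M.∙ γ) * J* β γ
      summation : ∀ α₁ α₂ α₃ α₄ →
                  ΣM (λ β → J (α₁ M.∙ β) (α₂ M.∙ (β M.⁻¹))
                          * J (α₃ M.∙ β) (α₄ M.∙ (β M.⁻¹)))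
                  ≈ J (α₁ M.∙ α₄) (α₂ M.∙ α₃)

  ⊕[_] : Bijection CharSetoid CharSetoid → Character → Character → Character
  ⊕[ i ] x y = x · (Bijection.to i (x / y) ⁻¹ᶜ)

{-# OPTIONS --safe #-}

-- Write κ x = i(x) x⁻¹, so that m J(α,β) = Σₓ α(i x) β(κ x). Expanding, m² J(α,β) J(αβ,γ) is a sum
-- over pairs (x, y) of dual elements of the product character (i x · i y)(α) (κ x · i y)(β) (κ y)(γ),
-- and m² J(α,βγ) J(β,γ) is the same sum for the triple (i x, κ x · i y, κ x · κ y). The cocycle law
-- makes the two products differ only by terms supported on αβ = 1 or βγ = 1, and these cancel in
-- the Fourier transform because α ↦ J(α,α⁻¹) and δ have the same transform. Comparing Fourier
-- coefficients, every triple (X, Y, Z) of characters is hit by as many pairs on the left as on the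
-- right. With w = (x ⊕ y) ⊕ z, the pair (x/y, (x ⊕ y)/z) hits (x/w, y/w, z/w) on the left, so some
-- pair hits it on the right, and any such pair forces x ⊕ (y ⊕ z) = w.

module Submission where

open import Defs
open import Level using (Level; _⊔_)
open import Function.Base using (_∘_)
open import Function.Bundles using (Bijection)
open import Algebra.Bundles using (CommutativeRing; AbelianGroup; Group)
import Algebra.Properties.CommutativeSemigroup as CommSemigroupProperties
import Algebra.Properties.AbelianGroup as AbelianGroupProperties
import Algebra.Properties.Ring as RingProperties
open import Data.Nat as ℕ using (zero; suc)
import Data.Nat.Properties as ℕₚ
open import Data.List using (List; []; _∷_; map; length)
open import Data.List.Relation.Unary.All as All using (All; []; _∷_)
open import Data.List.Relation.Unary.Any as Any using (Any; here; there)
open import Data.List.Relation.Unary.AllPairs using ([]; _∷_)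
open import Data.List.Relation.Unary.All.Properties using (¬Any⇒All¬)
import Data.List.Membership.Setoid as SetoidMembership
import Data.List.Membership.Propositional as PropMembership
import Data.List.Relation.Unary.Unique.Setoid as UniqueS
import Data.List.Relation.Unary.Unique.Propositional as UniqueP
open import Data.Product using (∃; ∃₂; _×_; _,_)
open import Data.Bool using (if_then_else_)
open import Relation.Nullary using (¬_; Dec; yes; no; contradiction)
open import Relation.Nullary.Decidable using (⌊_⌋; _×-dec_)
open import Relation.Binary.Bundles using (Setoid)
open import Relation.Binary.Definitions using (DecidableEquality)
open import Relation.Binary.PropositionalEquality as ≡ using (_≡_; _≢_)

module ListSum {c ℓ} (R : CommutativeRing c ℓ) where
  open CommutativeRing R
  open RingUtils R using (sumL; fromℕ)
  open CommSemigroupProperties +-commutativeSemigroup using (interchange)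
  open import Relation.Binary.Reasoning.Setoid setoid

  ∑ : ∀ {a} {A : Set a} → List A → (A → Carrier) → Carrier
  ∑ l f = sumL (map f l)

  module _ {a} {A : Set a} where

    ∑-cong : ∀ (l : List A) {f g : A → Carrier} → (∀ x → f x ≈ g x) → ∑ l f ≈ ∑ l g
    ∑-cong []      f≈g = refl
    ∑-cong (x ∷ l) f≈g = +-cong (f≈g x) (∑-cong l f≈g)

    ∑-zero : ∀ {l : List A} {f : A → Carrier} → All (λ x → f x ≈ 0#) l → ∑ l f ≈ 0#
    ∑-zero []            = refl
    ∑-zero (fx≈0 ∷ rest) = trans (+-cong fx≈0 (∑-zero rest)) (+-identityˡ 0#)

    ∑-distrib-+ : ∀ (l : List A) (f g : A → Carrier) →
                  ∑ l (λ x → f x + g x) ≈ ∑ l f + ∑ l g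
    ∑-distrib-+ []      f g = sym (+-identityˡ 0#)
    ∑-distrib-+ (x ∷ l) f g =
      trans (+-congˡ (∑-distrib-+ l f g)) (interchange (f x) (g x) (∑ l f) (∑ l g))

    *-distribˡ-∑ : ∀ (l : List A) k (f : A → Carrier) → k * ∑ l f ≈ ∑ l (λ x → k * f x)
    *-distribˡ-∑ []      k f = zeroʳ k
    *-distribˡ-∑ (x ∷ l) k f = trans (distribˡ k (f x) (∑ l f)) (+-congˡ (*-distribˡ-∑ l k f))

    *-distribʳ-∑ : ∀ (l : List A) k (f : A → Carrier) → ∑ l f * k ≈ ∑ l (λ x → f x * k)
    *-distribʳ-∑ l k f =
      trans (*-comm (∑ l f) k) (trans (*-distribˡ-∑ l k f) (∑-cong l (λ x → *-comm k (f x))))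

    ∑-const : ∀ (l : List A) k → ∑ l (λ _ → k) ≈ fromℕ (length l) * k
    ∑-const []      k = sym (zeroˡ k)
    ∑-const (x ∷ l) k = begin
      k + ∑ l (λ _ → k)               ≈⟨ +-cong (sym (*-identityˡ k)) (∑-const l k) ⟩
      1# * k + fromℕ (length l) * k   ≈⟨ distribʳ k 1# (fromℕ (length l)) ⟨
      (1# + fromℕ (length l)) * k     ∎

  ∑-comm : ∀ {a b} {A : Set a} {B : Set b} (l₁ : List A) (l₂ : List B) (f : A → B → Carrier) →
           ∑ l₁ (λ x → ∑ l₂ (f x)) ≈ ∑ l₂ (λ y → ∑ l₁ (λ x → f x y))
  ∑-comm []       l₂ f = sym (∑-zero (All.universal (λ _ → refl) l₂))
  ∑-comm (x ∷ l₁) l₂ f = trans (+-congˡ (∑-comm l₁ l₂ f)) (sym (∑-distrib-+ l₂ (f x) _))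

  ∑-product : ∀ {a b} {A : Set a} {B : Set b} (l₁ : List A) (l₂ : List B) f g →
              ∑ l₁ f * ∑ l₂ g ≈ ∑ l₁ (λ x → ∑ l₂ (λ y → f x * g y))
  ∑-product l₁ l₂ f g =
    trans (*-distribʳ-∑ l₁ (∑ l₂ g) f) (∑-cong l₁ (λ x → *-distribˡ-∑ l₂ (f x) g))

  module _ {a e} (S : Setoid a e) where
    open Setoid S using () renaming (Carrier to A; _≈_ to _≈ₛ_; sym to symₛ; trans to transₛ)
    open SetoidMembership S using (_∈_)
    open UniqueS S using (Unique)

    ∑-sift : ∀ {l} → Unique l → (f : A → Carrier) → (∀ {x y} → x ≈ₛ y → f x ≈ f y) →
             ∀ {t} → (∀ x → ¬ x ≈ₛ t → f x ≈ 0#) → t ∈ l → ∑ l f ≈ f t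
    ∑-sift (x≉rest ∷ _) f f-cong off (here t≈x) =
      trans (+-cong (f-cong (symₛ t≈x)) (∑-zero (All.map (λ x≉y → off _ (λ y≈t → x≉y (symₛ (transₛ y≈t t≈x)))) x≉rest)))
            (+-identityʳ _)
    ∑-sift (x≉rest ∷ rest) f f-cong off (there t∈rest) with All.lookupAny x≉rest t∈rest
    ... | x≉y , t≈y =
      trans (+-cong (off _ (λ x≈t → x≉y (transₛ x≈t t≈y))) (∑-sift rest f f-cong off t∈rest))
            (+-identityˡ _)

module _ {a e} (S : Setoid a e) where
  open Setoid S
  open SetoidMembership S using (_∈_)
  open UniqueS S using (Unique)

  Unique⇒≈-dec : ∀ {l} → Unique l → ∀ {x y} → x ∈ l → y ∈ l → Dec (x ≈ y)
  Unique⇒≈-dec (_ ∷ _) (here x≈z) (here y≈z) = yes (trans x≈z (sym y≈z))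
  Unique⇒≈-dec (z≉rest ∷ _) (here x≈z) (there y∈rest) with All.lookupAny z≉rest y∈rest
  ... | z≉u , y≈u = no (λ x≈y → z≉u (trans (sym x≈z) (trans x≈y y≈u)))
  Unique⇒≈-dec (z≉rest ∷ _) (there x∈rest) (here y≈z) with All.lookupAny z≉rest x∈rest
  ... | z≉u , x≈u = no (λ x≈y → z≉u (trans (sym y≈z) (trans (sym x≈y) x≈u)))
  Unique⇒≈-dec (_ ∷ rest) (there x∈rest) (there y∈rest) = Unique⇒≈-dec rest x∈rest y∈rest

module FieldProperties {c ℓ} (K : ACF0 c ℓ) where
  open ACF0 K
  open import Relation.Binary.Reasoning.Setoid setoid

  *-cancelˡ-≉0 : ∀ {x y z} → ¬ x ≈ 0# → x * y ≈ x * z → y ≈ z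
  *-cancelˡ-≉0 {x} {y} {z} x≉0 xy≈xz with inverse x x≉0
  ... | x⁻¹ , xx⁻¹≈1 = begin
    y              ≈⟨ *-identityˡ y ⟨
    1# * y         ≈⟨ *-congʳ x⁻¹x≈1 ⟨
    x⁻¹ * x * y    ≈⟨ *-assoc x⁻¹ x y ⟩
    x⁻¹ * (x * y)  ≈⟨ *-congˡ xy≈xz ⟩
    x⁻¹ * (x * z)  ≈⟨ *-assoc x⁻¹ x z ⟨
    x⁻¹ * x * z    ≈⟨ *-congʳ x⁻¹x≈1 ⟩
    1# * z         ≈⟨ *-identityˡ z ⟩
    z              ∎
    where x⁻¹x≈1 = trans (*-comm x⁻¹ x) xx⁻¹≈1

  x≉0∧xy≈0⇒y≈0 : ∀ {x y} → ¬ x ≈ 0# → x * y ≈ 0# → y ≈ 0#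
  x≉0∧xy≈0⇒y≈0 {x} x≉0 xy≈0 = *-cancelˡ-≉0 x≉0 (trans xy≈0 (sym (zeroʳ x)))

  x≉0∧y≉0⇒xy≉0 : ∀ {x y} → ¬ x ≈ 0# → ¬ y ≈ 0# → ¬ x * y ≈ 0#
  x≉0∧y≉0⇒xy≉0 x≉0 y≉0 xy≈0 = y≉0 (x≉0∧xy≈0⇒y≈0 x≉0 xy≈0)

module NatMultiples {c ℓ} (K : ACF0 c ℓ) (u : ACF0.Carrier K) where
  open ACF0 K
  open ListSum commutativeRing
  open FieldProperties K

  IsMultiple IsPositiveMultiple : Carrier → Set ℓ
  IsMultiple v         = ∃ λ n → v ≈ fromℕ n * u
  IsPositiveMultiple v = ∃ λ n → v ≈ fromℕ (suc n) * u

  fromℕ-+ : ∀ j k → fromℕ (j ℕ.+ k) ≈ fromℕ j + fromℕ k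
  fromℕ-+ zero    k = sym (+-identityˡ (fromℕ k))
  fromℕ-+ (suc j) k = trans (+-congˡ (fromℕ-+ j k)) (sym (+-assoc 1# (fromℕ j) (fromℕ k)))

  private
    multiple-+ : ∀ {v w} j k → v ≈ fromℕ j * u → w ≈ fromℕ k * u → v + w ≈ fromℕ (j ℕ.+ k) * u
    multiple-+ j k v≈ w≈ =
      trans (+-cong v≈ w≈) (trans (sym (distribʳ u (fromℕ j) (fromℕ k))) (*-congʳ (sym (fromℕ-+ j k))))

  ∑-multiple : ∀ {a} {A : Set a} (l : List A) (f : A → Carrier) →
               (∀ x → IsMultiple (f x)) → IsMultiple (∑ l f)
  ∑-multiple []      f mult = 0 , sym (zeroˡ u)
  ∑-multiple (x ∷ l) f mult with mult x | ∑-multiple l f mult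
  ... | j , fx≈ | k , rest≈ = j ℕ.+ k , multiple-+ j k fx≈ rest≈

  ∑-positiveMultiple : ∀ {a} {A : Set a} (l : List A) (f : A → Carrier) →
                       (∀ x → IsMultiple (f x)) → Any (λ x → IsPositiveMultiple (f x)) l →
                       IsPositiveMultiple (∑ l f)
  ∑-positiveMultiple (x ∷ l) f mult (here (j , fx≈)) with ∑-multiple l f mult
  ... | k , rest≈ = j ℕ.+ k , multiple-+ (suc j) k fx≈ rest≈
  ∑-positiveMultiple (x ∷ l) f mult (there pos) with mult x | ∑-positiveMultiple l f mult pos
  ... | j , fx≈ | k , rest≈ =
    j ℕ.+ k , trans (multiple-+ j (suc k) fx≈ rest≈) (*-congʳ (reflexive (≡.cong fromℕ (ℕₚ.+-suc j k))))

  positiveMultiple-≉0 : ¬ u ≈ 0# → ∀ {v} → IsPositiveMultiple v → ¬ v ≈ 0#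
  positiveMultiple-≉0 u≉0 (n , v≈) v≈0 = x≉0∧y≉0⇒xy≉0 (char0 n) u≉0 (trans (sym v≈) v≈0)

module Indicator {a c ℓ} {A : Set a} (_≟_ : DecidableEquality A) (R : CommutativeRing c ℓ) where
  open CommutativeRing R
  open ListSum R
  open PropMembership using (_∈_)
  open import Relation.Binary.Reasoning.Setoid setoid

  𝟙[_≡_] : A → A → Carrier
  𝟙[ p ≡ q ] = if ⌊ p ≟ q ⌋ then 1# else 0#

  𝟙-≡ : ∀ {p q} → p ≡ q → 𝟙[ p ≡ q ] ≈ 1#
  𝟙-≡ {p} {q} p≡q with p ≟ q
  ... | yes _  = refl
  ... | no p≢q = contradiction p≡q p≢q

  𝟙-≢ : ∀ {p q} → p ≢ q → 𝟙[ p ≡ q ] ≈ 0#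
  𝟙-≢ {p} {q} p≢q with p ≟ q
  ... | yes p≡q = contradiction p≡q p≢q
  ... | no _    = refl

  𝟙-*-cong : ∀ {p q u v} → (p ≡ q → u ≈ v) → 𝟙[ p ≡ q ] * u ≈ 𝟙[ p ≡ q ] * v
  𝟙-*-cong {p} {q} u≈v with p ≟ q
  ... | yes p≡q = *-congˡ (u≈v p≡q)
  ... | no _    = trans (zeroˡ _) (sym (zeroˡ _))

  module _ {l : List A} (unique : UniqueP.Unique l) (complete : ∀ x → x ∈ l) where

    ∑-sift≡ : (f : A → Carrier) (t : A) → (∀ x → x ≢ t → f x ≈ 0#) → ∑ l f ≈ f t
    ∑-sift≡ f t off = ∑-sift (≡.setoid A) unique f (λ x≡y → reflexive (≡.cong f x≡y)) off (complete t)

    ∑-reindex : (φ ψ : A → A) → (∀ x → ψ (φ x) ≡ x) → (∀ y → φ (ψ y) ≡ y) →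
                (f : A → Carrier) → ∑ l (f ∘ φ) ≈ ∑ l f
    ∑-reindex φ ψ ψφ φψ f = begin
      ∑ l (f ∘ φ)                                 ≈⟨ ∑-cong l fiber-over-image ⟨
      ∑ l (λ x → ∑ l (λ y → 𝟙[ φ x ≡ y ] * f y))  ≈⟨ ∑-comm l l _ ⟩
      ∑ l (λ y → ∑ l (λ x → 𝟙[ φ x ≡ y ] * f y))  ≈⟨ ∑-cong l fiber ⟩
      ∑ l f                                       ∎
      where
      fiber-over-image : ∀ x → ∑ l (λ y → 𝟙[ φ x ≡ y ] * f y) ≈ f (φ x)
      fiber-over-image x =
        trans (∑-sift≡ _ (φ x) (λ y y≢φx → trans (*-congʳ (𝟙-≢ (λ φx≡y → y≢φx (≡.sym φx≡y)))) (zeroˡ _)))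
              (trans (*-congʳ (𝟙-≡ ≡.refl)) (*-identityˡ _))
      fiber : ∀ y → ∑ l (λ x → 𝟙[ φ x ≡ y ] * f y) ≈ f y
      fiber y =
        trans (∑-sift≡ _ (ψ y) (λ x x≢ψy → trans (*-congʳ (𝟙-≢ (λ φx≡y →
                 x≢ψy (≡.trans (≡.sym (ψφ x)) (≡.cong ψ φx≡y))))) (zeroˡ _)))
              (trans (*-congʳ (𝟙-≡ (φψ y))) (*-identityˡ _))

module Oplus {a ℓ} (G : AbelianGroup a ℓ) (ι : AbelianGroup.Carrier G → AbelianGroup.Carrier G)
                   (ι-cong : ∀ {x y} → AbelianGroup._≈_ G x y → AbelianGroup._≈_ G (ι x) (ι y)) where
  open AbelianGroup G
  open Group group using (_//_)
  open AbelianGroupProperties G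
  open CommSemigroupProperties commutativeSemigroup using (xy∙z≈xz∙y; xy∙z≈y∙xz)
  open import Relation.Binary.Reasoning.Setoid setoid

  _⊕_ : Carrier → Carrier → Carrier
  x ⊕ y = x // ι (x // y)

  κ : Carrier → Carrier
  κ x = ι x // x

  κ-cong : ∀ {x y} → x ≈ y → κ x ≈ κ y
  κ-cong x≈y = //-cong₂ (ι-cong x≈y) x≈y

  x//[y//z]≈xz//y : ∀ x y z → x // (y // z) ≈ (x ∙ z) // y
  x//[y//z]≈xz//y x y z = trans (∙-congˡ (⁻¹-anti-homo-// y z)) (sym (assoc x z (y ⁻¹)))

  x//[x//y]≈y : ∀ x y → x // (x // y) ≈ y
  x//[x//y]≈y x y = trans (x//[y//z]≈xz//y x x y) (xyx⁻¹≈y x y)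

  [x//y]//z≈x//yz : ∀ x y z → (x // y) // z ≈ x // (y ∙ z)
  [x//y]//z≈x//yz x y z = trans (assoc x (y ⁻¹) (z ⁻¹)) (∙-congˡ (⁻¹-∙-comm y z))

  [x//z]//[y//z]≈x//y : ∀ x y z → (x // z) // (y // z) ≈ x // y
  [x//z]//[y//z]≈x//y x y z = trans (x//[y//z]≈xz//y (x // z) y z) (∙-congʳ (//-rightDividesˡ z x))

  module _ (x y z : Carrier) where
    private
      d = x // y
      e = (x ⊕ y) // z
      w = (x ⊕ y) ⊕ z

    ⊕-left-triple₁ : ι d ∙ ι e ≈ x // w
    ⊕-left-triple₁ = begin
      ι d ∙ ι e                    ≈⟨ x//[x//y]≈y x (ι d ∙ ι e) ⟨
      x // (x // (ι d ∙ ι e))      ≈⟨ //-cong₂ refl ([x//y]//z≈x//yz x (ι d) (ι e)) ⟨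
      x // w                       ∎

    ⊕-left-triple₂ : κ d ∙ ι e ≈ y // w
    ⊕-left-triple₂ = begin
      κ d ∙ ι e                    ≈⟨ ∙-congʳ (x//[y//z]≈xz//y (ι d) x y) ⟩
      ((ι d ∙ y) // x) ∙ ι e       ≈⟨ xy∙z≈xz∙y (ι d ∙ y) (x ⁻¹) (ι e) ⟩
      (ι d ∙ y ∙ ι e) // x         ≈⟨ ∙-congʳ (xy∙z≈y∙xz (ι d) y (ι e)) ⟩
      (y ∙ (ι d ∙ ι e)) // x       ≈⟨ x//[y//z]≈xz//y y x (ι d ∙ ι e) ⟨
      y // (x // (ι d ∙ ι e))      ≈⟨ //-cong₂ refl ([x//y]//z≈x//yz x (ι d) (ι e)) ⟨
      y // w                       ∎

    ⊕-left-triple₃ : κ e ≈ z // w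
    ⊕-left-triple₃ = begin
      ι e // ((x ⊕ y) // z)        ≈⟨ x//[y//z]≈xz//y (ι e) (x ⊕ y) z ⟩
      (ι e ∙ z) // (x ⊕ y)         ≈⟨ ∙-congʳ (comm (ι e) z) ⟩
      (z ∙ ι e) // (x ⊕ y)         ≈⟨ x//[y//z]≈xz//y z (x ⊕ y) (ι e) ⟨
      z // w                       ∎

  ⊕-assoc-from-right-triple : ∀ {x y z w d e} →
    ι d ≈ x // w → κ d ∙ ι e ≈ y // w → κ d ∙ κ e ≈ z // w → x ⊕ (y ⊕ z) ≈ w
  ⊕-assoc-from-right-triple {x} {y} {z} {w} {d} {e} h₁ h₂ h₃ = begin
    x // ι (x // (y ⊕ z))   ≈⟨ //-cong₂ refl (ι-cong d≈) ⟨
    x // ι d                ≈⟨ //-cong₂ refl h₁ ⟩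
    x // (x // w)           ≈⟨ x//[x//y]≈y x w ⟩
    w                       ∎
    where
    e≈ : e ≈ y // z
    e≈ = begin
      e                                   ≈⟨ x//[x//y]≈y (κ d ∙ ι e) e ⟨
      (κ d ∙ ι e) // ((κ d ∙ ι e) // e)   ≈⟨ //-cong₂ refl (assoc (κ d) (ι e) (e ⁻¹)) ⟩
      (κ d ∙ ι e) // (κ d ∙ κ e)          ≈⟨ //-cong₂ h₂ h₃ ⟩
      (y // w) // (z // w)                ≈⟨ [x//z]//[y//z]≈x//y y z w ⟩
      y // z                              ∎
    κd≈ : κ d ≈ (y ⊕ z) // w
    κd≈ = begin
      κ d                       ≈⟨ //-rightDividesʳ (ι e) (κ d) ⟨
      (κ d ∙ ι e) // ι e        ≈⟨ //-cong₂ h₂ (ι-cong e≈) ⟩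
      (y // w) // ι (y // z)    ≈⟨ xy∙z≈xz∙y y (w ⁻¹) (ι (y // z) ⁻¹) ⟩
      (y ⊕ z) // w              ∎
    d≈ : d ≈ x // (y ⊕ z)
    d≈ = begin
      d                         ≈⟨ x//[x//y]≈y (ι d) d ⟨
      ι d // κ d                ≈⟨ //-cong₂ h₁ κd≈ ⟩
      (x // w) // ((y ⊕ z) // w) ≈⟨ [x//z]//[y//z]≈x//y x (y ⊕ z) w ⟩
      x // (y ⊕ z)              ∎

module CocycleDefect (M : FiniteAbelianGroup) {c ℓ} (K : ACF0 c ℓ)
  (J : FiniteAbelianGroup.Carrier M → FiniteAbelianGroup.Carrier M → ACF0.Carrier K) where
  private module M = FiniteAbelianGroup M
  open M using (_∙_; _⁻¹)
  open ACF0 K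
  open Dual M K using (δ)
  -- δ α is definitionally 𝟙[ α ≡ ε ].
  open Indicator M._≟_ commutativeRing
  open import Algebra.Properties.AbelianGroup +-abelianGroup using (//-rightDividesˡ)
  open import Algebra.Properties.Group M.group using (inverseʳ-unique)
  open import Algebra.Solver.Ring.NaturalCoefficients.Default commutativeSemiring using (solve; _:+_; _:*_; _:=_)
  open import Relation.Binary.Reasoning.Setoid setoid

  J* : M.Carrier → M.Carrier → Carrier
  J* α β = J α β - δ α - δ β

  J≈J*+δ+δ : ∀ α β → J α β ≈ J* α β + δ β + δ α
  J≈J*+δ+δ α β = sym (trans (+-congʳ (//-rightDividesˡ (δ β) (J α β - δ α))) (//-rightDividesˡ (δ α) (J α β)))

  private
    J-cong₂ : ∀ {α α′ β β′} → α ≡ α′ → β ≡ β′ → J α β ≈ J α′ β′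
    J-cong₂ α≡α′ β≡β′ = reflexive (≡.cong₂ J α≡α′ β≡β′)

    J*-cong₂ : ∀ {α α′ β β′} → α ≡ α′ → β ≡ β′ → J* α β ≈ J* α′ β′
    J*-cong₂ α≡α′ β≡β′ = reflexive (≡.cong₂ J* α≡α′ β≡β′)

    ε∙-≡ : ∀ {α} β → α ≡ M.ε → α ∙ β ≡ β
    ε∙-≡ β α≡ε = ≡.trans (≡.cong (_∙ β) α≡ε) (M.identityˡ β)

    ∙ε-≡ : ∀ α {β} → β ≡ M.ε → α ∙ β ≡ α
    ∙ε-≡ α β≡ε = ≡.trans (≡.cong (α ∙_) β≡ε) (M.identityʳ α)

  module _ (cocycle : ∀ α β γ → J* α β * J* (α ∙ β) γ ≈ J* α (β ∙ γ) * J* β γ) where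

    -- J(α,β)J(αβ,γ) − J(α,βγ)J(β,γ) = δ(αβ)(J(α,α⁻¹) − δ(α)) − δ(βγ)(J(β,β⁻¹) − δ(β)),
    -- with the terms moved so that no subtraction occurs.
    cocycle-defect : ∀ α β γ →
      J α β * J (α ∙ β) γ + (δ (α ∙ β) * δ α + δ (β ∙ γ) * J β (β ⁻¹))
      ≈ J α (β ∙ γ) * J β γ + (δ (α ∙ β) * J α (α ⁻¹) + δ (β ∙ γ) * δ β)
    cocycle-defect α β γ = begin
      J α β * J (α ∙ β) γ + (δαβ * δα + δβγ * J β (β ⁻¹))
        ≈⟨ +-cong (*-cong (J≈J*+δ+δ α β) (J≈J*+δ+δ (α ∙ β) γ))
                  (+-congˡ (trans (𝟙-*-cong (λ βγ≡ε → J-cong₂ ≡.refl (≡.sym (inverseʳ-unique β γ βγ≡ε))))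
                                  (*-congˡ (J≈J*+δ+δ β γ)))) ⟩
      (a + δβ + δα) * (b + δγ + δαβ) + (δαβ * δα + δβγ * (d + δγ + δβ))
        ≈⟨ solve 8 (λ a b d δα δβ δγ δαβ δβγ →
             (a :+ δβ :+ δα) :* (b :+ δγ :+ δαβ) :+ (δαβ :* δα :+ δβγ :* (d :+ δγ :+ δβ))
             := (a :* b :+ δγ :* a :+ δα :* b :+ δβ :* b :+ δα :* δαβ :+ δβ :* δγ)
                :+ (δαβ :* a :+ δα :* δγ :+ δβ :* δαβ :+ δαβ :* δα :+ δβγ :* d :+ δβγ :* δβ :+ δβγ :* δγ))
             refl a b d δα δβ δγ δαβ δβγ ⟩
      (a * b + δγ * a + δα * b + δβ * b + δα * δαβ + δβ * δγ) + rest
        ≈⟨ +-congʳ core-left≈core-right ⟩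
      (c′ * d + δγ * c′ + δα * d + δβ * c′ + δα * δβ + δβ * δβγ) + rest
        ≈⟨ solve 8 (λ a c′ d δα δβ δγ δαβ δβγ →
             (c′ :* d :+ δγ :* c′ :+ δα :* d :+ δβ :* c′ :+ δα :* δβ :+ δβ :* δβγ)
                :+ (δαβ :* a :+ δα :* δγ :+ δβ :* δαβ :+ δαβ :* δα :+ δβγ :* d :+ δβγ :* δβ :+ δβγ :* δγ)
             := (c′ :+ δβγ :+ δα) :* (d :+ δγ :+ δβ) :+ (δαβ :* (a :+ δβ :+ δα) :+ δβγ :* δβ))
             refl a c′ d δα δβ δγ δαβ δβγ ⟩
      (c′ + δβγ + δα) * (d + δγ + δβ) + (δαβ * (a + δβ + δα) + δβγ * δβ)
        ≈⟨ +-cong (*-cong (J≈J*+δ+δ α (β ∙ γ)) (J≈J*+δ+δ β γ))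
                  (+-congʳ (trans (𝟙-*-cong (λ αβ≡ε → J-cong₂ ≡.refl (≡.sym (inverseʳ-unique α β αβ≡ε))))
                                  (*-congˡ (J≈J*+δ+δ α β)))) ⟨
      J α (β ∙ γ) * J β γ + (δαβ * J α (α ⁻¹) + δβγ * δβ) ∎
      where
      a = J* α β
      b = J* (α ∙ β) γ
      c′ = J* α (β ∙ γ)
      d = J* β γ
      δα = δ α
      δβ = δ β
      δγ = δ γ
      δαβ = δ (α ∙ β)
      δβγ = δ (β ∙ γ)
      rest = δαβ * a + δα * δγ + δβ * δαβ + δαβ * δα + δβγ * d + δβγ * δβ + δβγ * δγ
      core-left≈core-right : a * b + δγ * a + δα * b + δβ * b + δα * δαβ + δβ * δγ
                             ≈ c′ * d + δγ * c′ + δα * d + δβ * c′ + δα * δβ + δβ * δβγ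
      core-left≈core-right =
        +-cong (+-cong (+-cong (+-cong (+-cong (cocycle α β γ)
          (𝟙-*-cong (λ γ≡ε → J*-cong₂ ≡.refl (≡.sym (∙ε-≡ β γ≡ε)))))
          (𝟙-*-cong (λ α≡ε → J*-cong₂ (ε∙-≡ β α≡ε) ≡.refl)))
          (𝟙-*-cong (λ β≡ε → J*-cong₂ (∙ε-≡ α β≡ε) (≡.sym (ε∙-≡ γ β≡ε)))))
          (𝟙-*-cong (λ α≡ε → reflexive (≡.cong δ (ε∙-≡ β α≡ε)))))
          (𝟙-*-cong (λ β≡ε → reflexive (≡.cong δ (≡.sym (ε∙-≡ γ β≡ε)))))

module Characters (M : FiniteAbelianGroup) {c ℓ} (K : ACF0 c ℓ) where
  private module M = FiniteAbelianGroup M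
  open M using (_∙_; _⁻¹)
  open ACF0 K
  open Dual M K
  open ListSum commutativeRing
  open FieldProperties K
  open Indicator M._≟_ commutativeRing
  open import Algebra.Properties.Group M.group using (inverseʳ-unique; //-rightDividesˡ; //-rightDividesʳ)
  open import Algebra.Properties.AbelianGroup +-abelianGroup using (x∙y⁻¹≈ε⇒x≈y)
  open RingProperties ring using ([y-z]x≈yx-zx)
  open CommSemigroupProperties *-commutativeSemigroup using (interchange)
  open import Algebra.Solver.Ring.NaturalCoefficients.Default commutativeSemiring using (solve; _:+_; _:*_; _:=_)
  open import Relation.Binary.Reasoning.Setoid setoid

  m : Carrier
  m = fromℕ M.order

  m≉0 : ¬ m ≈ 0#
  m≉0 with M.elements | M.complete M.ε
  ... | _ ∷ rest | _ = char0 (length rest)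

  -- A record wrapper, so that both sides of a character equation can be inferred.
  record _≃_ (x y : Character) : Set ℓ where
    constructor mk≃
    field un≃ : x ≈ᶜ y
  open _≃_ public
  infix 4 _≃_

  1ᶜ : Character
  1ᶜ = record { χ = λ _ → 1# ; hom = λ _ _ → sym (*-identityˡ 1#) ; unit = refl }

  χ-inverse : ∀ x α → χ x α * χ x (α ⁻¹) ≈ 1#
  χ-inverse x α = trans (sym (hom x α (α ⁻¹))) (trans (reflexive (≡.cong (χ x) (M.inverseʳ α))) (unit x))

  characterGroup : AbelianGroup (c ⊔ ℓ) ℓ
  characterGroup = record
    { Carrier = Character ; _≈_ = _≃_ ; _∙_ = _·_ ; ε = 1ᶜ ; _⁻¹ = _⁻¹ᶜ
    ; isAbelianGroup = record
      { isGroup = record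
        { isMonoid = record
          { isSemigroup = record
            { isMagma = record
              { isEquivalence = record
                { refl  = mk≃ (λ _ → refl)
                ; sym   = λ x≃y → mk≃ (λ α → sym (un≃ x≃y α))
                ; trans = λ x≃y y≃z → mk≃ (λ α → trans (un≃ x≃y α) (un≃ y≃z α)) }
              ; ∙-cong = λ x≃y u≃v → mk≃ (λ α → *-cong (un≃ x≃y α) (un≃ u≃v α)) }
            ; assoc = λ _ _ _ → mk≃ (λ _ → *-assoc _ _ _) }
          ; identity = (λ _ → mk≃ (λ _ → *-identityˡ _)) , (λ _ → mk≃ (λ _ → *-identityʳ _)) }
        ; inverse = (λ x → mk≃ (λ α → trans (*-comm _ _) (χ-inverse x α))) , (λ x → mk≃ (χ-inverse x))
        ; ⁻¹-cong = λ x≃y → mk≃ (λ α → un≃ x≃y (α ⁻¹)) }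
      ; comm = λ _ _ → mk≃ (λ _ → *-comm _ _) } }

  open AbelianGroup characterGroup public using ()
    renaming (refl to ≃-refl; sym to ≃-sym; trans to ≃-trans; ∙-cong to ·-cong)
  private module CG = AbelianGroupProperties characterGroup

  ∑-δ : ∀ (f : M.Carrier → Carrier) → ΣM (λ α → δ α * f α) ≈ f M.ε
  ∑-δ f = trans (∑-sift≡ M.distinct M.complete (λ α → δ α * f α) M.ε (λ α α≢ε → trans (*-congʳ (𝟙-≢ α≢ε)) (zeroˡ _)))
                (trans (*-congʳ (𝟙-≡ ≡.refl)) (*-identityˡ _))

  ∑-δ∙ : ∀ α (f : M.Carrier → Carrier) → ΣM (λ β → δ (α ∙ β) * f β) ≈ f (α ⁻¹)
  ∑-δ∙ α f = trans (∑-sift≡ M.distinct M.complete (λ β → δ (α ∙ β) * f β) (α ⁻¹)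
                      (λ β β≢α⁻¹ → trans (*-congʳ (𝟙-≢ (λ αβ≡ε → β≢α⁻¹ (inverseʳ-unique α β αβ≡ε)))) (zeroˡ _)))
                   (trans (*-congʳ (𝟙-≡ (M.inverseʳ α))) (*-identityˡ _))

  Δ : Character → Carrier
  Δ r = ΣM (χ r)

  Δ-cong : ∀ {r r′} → r ≃ r′ → Δ r ≈ Δ r′
  Δ-cong r≃r′ = ∑-cong M.elements (un≃ r≃r′)

  Δ-translate : ∀ r α → Δ r * χ r α ≈ Δ r
  Δ-translate r α = begin
    Δ r * χ r α                ≈⟨ *-distribʳ-∑ M.elements (χ r α) (χ r) ⟩
    ΣM (λ β → χ r β * χ r α)   ≈⟨ ∑-cong M.elements (λ β → hom r β α) ⟨
    ΣM (λ β → χ r (β ∙ α))     ≈⟨ ∑-reindex M.distinct M.complete (_∙ α) (_∙ (α ⁻¹))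
                                    (//-rightDividesʳ α) (//-rightDividesˡ α) (χ r) ⟩
    Δ r                        ∎

  Δ-trivial : ∀ {r} → r ≃ 1ᶜ → Δ r ≈ m
  Δ-trivial r≃1 = trans (Δ-cong r≃1) (trans (∑-const M.elements 1#) (*-identityʳ m))

  Δ≈m⇒trivial : ∀ {r} → Δ r ≈ m → r ≃ 1ᶜ
  Δ≈m⇒trivial {r} Δr≈m = mk≃ λ α → *-cancelˡ-≉0 m≉0 (begin
    m * χ r α      ≈⟨ *-congʳ Δr≈m ⟨
    Δ r * χ r α    ≈⟨ Δ-translate r α ⟩
    Δ r            ≈⟨ Δr≈m ⟩
    m              ≈⟨ *-identityʳ m ⟨
    m * 1#         ∎)

  Δ-nontrivial : ∀ {r} → ¬ r ≃ 1ᶜ → Δ r ≈ 0#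
  Δ-nontrivial {r} r≄1 = x≉0∧xy≈0⇒y≈0 (λ Δr-m≈0 → r≄1 (Δ≈m⇒trivial (x∙y⁻¹≈ε⇒x≈y (Δ r) m Δr-m≈0))) (begin
    (Δ r - m) * Δ r          ≈⟨ [y-z]x≈yx-zx (Δ r) (Δ r) m ⟩
    Δ r * Δ r - m * Δ r      ≈⟨ +-congʳ Δ²≈mΔ ⟩
    m * Δ r - m * Δ r        ≈⟨ -‿inverseʳ (m * Δ r) ⟩
    0#                       ∎)
    where
    Δ²≈mΔ : Δ r * Δ r ≈ m * Δ r
    Δ²≈mΔ = begin
      Δ r * Δ r                ≈⟨ *-distribˡ-∑ M.elements (Δ r) (χ r) ⟩
      ΣM (λ α → Δ r * χ r α)   ≈⟨ ∑-cong M.elements (Δ-translate r) ⟩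
      ΣM (λ _ → Δ r)           ≈⟨ ∑-const M.elements (Δ r) ⟩
      m * Δ r                  ∎

  Δ-/-≃ : ∀ {A B} → A ≃ B → Δ (A / B) ≈ m
  Δ-/-≃ A≃B = Δ-trivial (CG.x≈y⇒x∙y⁻¹≈ε A≃B)

  Δ-/-≄ : ∀ {A B} → ¬ A ≃ B → Δ (A / B) ≈ 0#
  Δ-/-≄ {A} {B} A≄B = Δ-nontrivial (λ A/B≃1 → A≄B (CG.x∙y⁻¹≈ε⇒x≈y A B A/B≃1))

  private
    E = M.elements

  ∑₃ : (M.Carrier → M.Carrier → M.Carrier → Carrier) → Carrier
  ∑₃ f = ΣM λ α → ΣM λ β → ΣM λ γ → f α β γ

  ∑₃-cong : ∀ {f g} → (∀ α β γ → f α β γ ≈ g α β γ) → ∑₃ f ≈ ∑₃ g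
  ∑₃-cong f≈g = ∑-cong E λ α → ∑-cong E λ β → ∑-cong E (f≈g α β)

  ∑₃-distrib-+ : ∀ f g → ∑₃ (λ α β γ → f α β γ + g α β γ) ≈ ∑₃ f + ∑₃ g
  ∑₃-distrib-+ f g =
    trans (∑-cong E λ α → trans (∑-cong E λ β → ∑-distrib-+ E (f α β) (g α β)) (∑-distrib-+ E _ _))
          (∑-distrib-+ E _ _)

  *-distribˡ-∑₃ : ∀ k f → k * ∑₃ f ≈ ∑₃ (λ α β γ → k * f α β γ)
  *-distribˡ-∑₃ k f =
    trans (*-distribˡ-∑ E k _) (∑-cong E λ α → trans (*-distribˡ-∑ E k _) (∑-cong E λ β → *-distribˡ-∑ E k (f α β)))

  ∑₃-∑ : ∀ {a} {X : Set a} (l : List X) (g : M.Carrier → M.Carrier → M.Carrier → X → Carrier) →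
         ∑₃ (λ α β γ → ∑ l (g α β γ)) ≈ ∑ l (λ x → ∑₃ (λ α β γ → g α β γ x))
  ∑₃-∑ l g =
    trans (∑-cong E λ α → trans (∑-cong E λ β → ∑-comm E l (g α β)) (∑-comm E l _)) (∑-comm E l _)

  ∑₃-separable : ∀ f g h → ∑₃ (λ α β γ → f α * (g β * h γ)) ≈ ΣM f * (ΣM g * ΣM h)
  ∑₃-separable f g h = begin
    ∑₃ (λ α β γ → f α * (g β * h γ))
      ≈⟨ ∑-cong E (λ α → ∑-cong E λ β → trans (*-congˡ (*-distribˡ-∑ E (g β) h)) (*-distribˡ-∑ E (f α) _)) ⟨
    ΣM (λ α → ΣM λ β → f α * (g β * ΣM h))
      ≈⟨ ∑-cong E (λ α → trans (*-congˡ (*-distribʳ-∑ E (ΣM h) g)) (*-distribˡ-∑ E (f α) _)) ⟨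
    ΣM (λ α → f α * (ΣM g * ΣM h))
      ≈⟨ *-distribʳ-∑ E _ f ⟨
    ΣM f * (ΣM g * ΣM h) ∎

  transform : (M.Carrier → Carrier) → Character → Carrier
  transform f r = ΣM (λ α → f α * χ r α)

  transform₃ : (M.Carrier → M.Carrier → M.Carrier → Carrier) → Character → Character → Character → Carrier
  transform₃ f A B C = ∑₃ (λ α β γ → f α β γ * (χ A α * (χ B β * χ C γ)))

  module Transform₃ (A B C : Character) where

    transform₃-cong : ∀ {f g} → (∀ α β γ → f α β γ ≈ g α β γ) → transform₃ f A B C ≈ transform₃ g A B C
    transform₃-cong f≈g = ∑₃-cong (λ α β γ → *-congʳ (f≈g α β γ))

    transform₃-+ : ∀ f g → transform₃ (λ α β γ → f α β γ + g α β γ) A B C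
                           ≈ transform₃ f A B C + transform₃ g A B C
    transform₃-+ f g = trans (∑₃-cong (λ α β γ → distribʳ _ (f α β γ) (g α β γ))) (∑₃-distrib-+ _ _)

    transform₃-*ˡ : ∀ k f → transform₃ (λ α β γ → k * f α β γ) A B C ≈ k * transform₃ f A B C
    transform₃-*ˡ k f = trans (∑₃-cong (λ α β γ → *-assoc k (f α β γ) _)) (sym (*-distribˡ-∑₃ k _))

    transform₃-∑ : ∀ {a} {X : Set a} (l : List X) (f : X → M.Carrier → M.Carrier → M.Carrier → Carrier) →
                   transform₃ (λ α β γ → ∑ l (λ x → f x α β γ)) A B C ≈ ∑ l (λ x → transform₃ (f x) A B C)
    transform₃-∑ l f = trans (∑₃-cong (λ α β γ → *-distribʳ-∑ l _ (λ x → f x α β γ))) (∑₃-∑ l _)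

    transform₃-character : ∀ P Q R → transform₃ (λ α β γ → χ P α * (χ Q β * χ R γ)) A B C
                                     ≈ Δ (P · A) * (Δ (Q · B) * Δ (R · C))
    transform₃-character P Q R =
      trans (∑₃-cong (λ α β γ → trans (interchange (χ P α) _ (χ A α) _) (*-congˡ (interchange (χ Q β) (χ R γ) (χ B β) (χ C γ)))))
            (∑₃-separable (χ (P · A)) (χ (Q · B)) (χ (R · C)))

    transform₃-δ₁₂ : ∀ f → transform₃ (λ α β γ → δ (α ∙ β) * f α) A B C ≈ transform f (A / B) * Δ C
    transform₃-δ₁₂ f = begin
      transform₃ (λ α β γ → δ (α ∙ β) * f α) A B C
        ≈⟨ ∑₃-cong (λ α β γ → solve 5 (λ d f a b c → (d :* f) :* (a :* (b :* c)) := (d :* (f :* (a :* b))) :* c)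
                                       refl (δ (α ∙ β)) (f α) (χ A α) (χ B β) (χ C γ)) ⟩
      ∑₃ (λ α β γ → δ (α ∙ β) * (f α * (χ A α * χ B β)) * χ C γ)
        ≈⟨ ∑-cong E (λ α → ∑-cong E λ β → *-distribˡ-∑ E _ (χ C)) ⟨
      ΣM (λ α → ΣM λ β → δ (α ∙ β) * (f α * (χ A α * χ B β)) * Δ C)
        ≈⟨ ∑-cong E (λ α → *-distribʳ-∑ E (Δ C) _) ⟨
      ΣM (λ α → ΣM (λ β → δ (α ∙ β) * (f α * (χ A α * χ B β))) * Δ C)
        ≈⟨ ∑-cong E (λ α → *-congʳ (∑-δ∙ α (λ β → f α * (χ A α * χ B β)))) ⟩
      ΣM (λ α → f α * χ (A / B) α * Δ C)
        ≈⟨ *-distribʳ-∑ E (Δ C) _ ⟨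
      transform f (A / B) * Δ C ∎

    transform₃-δ₂₃ : ∀ f → transform₃ (λ α β γ → δ (β ∙ γ) * f β) A B C ≈ Δ A * transform f (B / C)
    transform₃-δ₂₃ f = begin
      transform₃ (λ α β γ → δ (β ∙ γ) * f β) A B C
        ≈⟨ ∑₃-cong (λ α β γ → solve 5 (λ d f a b c → (d :* f) :* (a :* (b :* c)) := a :* (d :* (f :* (b :* c))))
                                       refl (δ (β ∙ γ)) (f β) (χ A α) (χ B β) (χ C γ)) ⟩
      ∑₃ (λ α β γ → χ A α * (δ (β ∙ γ) * (f β * (χ B β * χ C γ))))
        ≈⟨ ∑-cong E (λ α → ∑-cong E λ β → *-distribˡ-∑ E (χ A α) _) ⟨
      ΣM (λ α → ΣM λ β → χ A α * ΣM (λ γ → δ (β ∙ γ) * (f β * (χ B β * χ C γ))))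
        ≈⟨ ∑-cong E (λ α → ∑-cong E λ β → *-congˡ (∑-δ∙ β (λ γ → f β * (χ B β * χ C γ)))) ⟩
      ΣM (λ α → ΣM λ β → χ A α * (f β * χ (B / C) β))
        ≈⟨ ∑-cong E (λ α → *-distribˡ-∑ E (χ A α) _) ⟨
      ΣM (λ α → χ A α * transform f (B / C))
        ≈⟨ *-distribʳ-∑ E _ (χ A) ⟨
      Δ A * transform f (B / C) ∎

module DualSums (M : FiniteAbelianGroup) {c ℓ} (K : ACF0 c ℓ) (D : Dual.DualEnumeration M K) where
  private module M = FiniteAbelianGroup M
  open ACF0 K
  open Dual M K
  open ListSum commutativeRing
  open Characters M K
  open DualEnumeration D renaming (characters to M̂)
  private module CG = AbelianGroupProperties characterGroup

  _≟ᶜ_ : ∀ x y → Dec (x ≃ y)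
  x ≟ᶜ y with Unique⇒≈-dec CharSetoid distinct {x} {y} (complete x) (complete y)
  ... | yes x≈ᶜy = yes (mk≃ x≈ᶜy)
  ... | no x≉ᶜy  = no (λ x≃y → x≉ᶜy (un≃ x≃y))

  any-M̂ : ∀ {p} {P : Character → Set p} → (∀ {x y} → x ≃ y → P x → P y) → ∀ {x} → P x → Any P M̂
  any-M̂ resp {x} Px = Any.map (λ x≈ᶜy → resp (mk≃ x≈ᶜy) Px) (complete x)

  ∑-Δ-·≈m : ∀ r → ∑ M̂ (λ x → Δ (x · r)) ≈ m
  ∑-Δ-·≈m r = trans
    (∑-sift CharSetoid distinct (λ x → Δ (x · r)) (λ {x} {y} x≈ᶜy → Δ-cong {x · r} {y · r} (·-cong (mk≃ x≈ᶜy) ≃-refl))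
            {r ⁻¹ᶜ} (λ x x≉r⁻¹ → Δ-nontrivial (λ xr≃1 → x≉r⁻¹ (un≃ (CG.inverseˡ-unique x r xr≃1))))
            (complete (r ⁻¹ᶜ)))
    (Δ-trivial (AbelianGroup.inverseˡ characterGroup r))

  Φ : (P Q R : Character → Character → Character) → M.Carrier → M.Carrier → M.Carrier → Carrier
  Φ P Q R α β γ = ∑ M̂ λ x → ∑ M̂ λ y → χ (P x y) α * (χ (Q x y) β * χ (R x y) γ)

  module _ (X Y Z : Character) where
    private
      m³ = m * (m * m)
    open FieldProperties K
    open NatMultiples K m³

    Matches : Character → Character → Character → Set ℓ
    Matches A B C = A ≃ X × B ≃ Y × C ≃ Z

    matches? : ∀ A B C → Dec (Matches A B C)
    matches? A B C = (A ≟ᶜ X) ×-dec ((B ≟ᶜ Y) ×-dec (C ≟ᶜ Z))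

    coincidence : Character → Character → Character → Carrier
    coincidence A B C = Δ (A / X) * (Δ (B / Y) * Δ (C / Z))

    coincidence-match : ∀ {A B C} → Matches A B C → IsPositiveMultiple (coincidence A B C)
    coincidence-match (A≃X , B≃Y , C≃Z) =
      0 , trans (*-cong (Δ-/-≃ A≃X) (*-cong (Δ-/-≃ B≃Y) (Δ-/-≃ C≃Z)))
                (sym (trans (*-congʳ (+-identityʳ 1#)) (*-identityˡ m³)))

    coincidence-mismatch : ∀ {A B C} → ¬ Matches A B C → coincidence A B C ≈ 0#
    coincidence-mismatch {A} {B} {C} mismatch with A ≟ᶜ X | B ≟ᶜ Y | C ≟ᶜ Z
    ... | yes A≃X | yes B≃Y | yes C≃Z = contradiction (A≃X , B≃Y , C≃Z) mismatch
    ... | no A≄X  | _       | _       = trans (*-congʳ (Δ-/-≄ A≄X)) (zeroˡ _)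
    ... | yes _   | no B≄Y  | _       = trans (*-congˡ (trans (*-congʳ (Δ-/-≄ B≄Y)) (zeroˡ _))) (zeroʳ _)
    ... | yes _   | yes _   | no C≄Z  = trans (*-congˡ (trans (*-congˡ (Δ-/-≄ C≄Z)) (zeroʳ _))) (zeroʳ _)

    coincidence-multiple : ∀ A B C → IsMultiple (coincidence A B C)
    coincidence-multiple A B C with matches? A B C
    ... | yes match    = let n , eq = coincidence-match match in suc n , eq
    ... | no mismatch  = 0 , trans (coincidence-mismatch mismatch) (sym (zeroˡ m³))

    -- m³ times the number of pairs (x, y) with (P x y, Q x y, R x y) ≃ (X, Y, Z).
    count : (P Q R : Character → Character → Character) → Carrier
    count P Q R = ∑ M̂ λ x → ∑ M̂ λ y → coincidence (P x y) (Q x y) (R x y)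

    module _ (P Q R : Character → Character → Character) where

      Match : Character → Character → Set ℓ
      Match x y = Matches (P x y) (Q x y) (R x y)

      transform₃-Φ : transform₃ (Φ P Q R) (X ⁻¹ᶜ) (Y ⁻¹ᶜ) (Z ⁻¹ᶜ) ≈ count P Q R
      transform₃-Φ = let open Transform₃ (X ⁻¹ᶜ) (Y ⁻¹ᶜ) (Z ⁻¹ᶜ) in
        trans (transform₃-∑ M̂ (λ x α β γ → ∑ M̂ λ y → χ (P x y) α * (χ (Q x y) β * χ (R x y) γ))) (∑-cong M̂ λ x →
        trans (transform₃-∑ M̂ (λ y α β γ → χ (P x y) α * (χ (Q x y) β * χ (R x y) γ))) (∑-cong M̂ λ y →
        transform₃-character (P x y) (Q x y) (R x y)))

      count-≉0 : Any (λ x → Any (Match x) M̂) M̂ → ¬ count P Q R ≈ 0#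
      count-≉0 match = positiveMultiple-≉0 (x≉0∧y≉0⇒xy≉0 m≉0 (x≉0∧y≉0⇒xy≉0 m≉0 m≉0))
        (∑-positiveMultiple M̂ row (λ x → ∑-multiple M̂ (entry x) (entry-multiple x))
          (Any.map (λ {x} → ∑-positiveMultiple M̂ (entry x) (entry-multiple x) ∘ Any.map coincidence-match) match))
        where
        entry : Character → Character → Carrier
        entry x y = coincidence (P x y) (Q x y) (R x y)
        entry-multiple : ∀ x y → IsMultiple (entry x y)
        entry-multiple x y = coincidence-multiple (P x y) (Q x y) (R x y)
        row : Character → Carrier
        row x = ∑ M̂ (entry x)

      count-≉0⇒match : ¬ count P Q R ≈ 0# → ∃₂ Match
      count-≉0⇒match count≉0 with Any.any? (λ x → Any.any? (λ y → matches? (P x y) (Q x y) (R x y)) M̂) M̂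
      ... | yes match = let x , matchY = Any.satisfied match ; y , xyMatch = Any.satisfied matchY in x , y , xyMatch
      ... | no noMatch = contradiction
        (∑-zero (All.map (λ noMatchY → ∑-zero (All.map coincidence-mismatch (¬Any⇒All¬ M̂ noMatchY))) (¬Any⇒All¬ M̂ noMatch)))
        count≉0

module Associativity (M : FiniteAbelianGroup) {c ℓ} (K : ACF0 c ℓ)
  (D : Dual.DualEnumeration M K) (i : Bijection (Dual.CharSetoid M K) (Dual.CharSetoid M K))
  (J : FiniteAbelianGroup.Carrier M → FiniteAbelianGroup.Carrier M → ACF0.Carrier K) where
  private module M = FiniteAbelianGroup M
  open M using (_∙_; _⁻¹)
  open ACF0 K
  open Dual M K
  open ListSum commutativeRing
  open FieldProperties K
  open Characters M K
  open DualSums M K D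
  open DualEnumeration D renaming (characters to M̂)
  open CocycleDefect M K J
  open AbelianGroupProperties +-abelianGroup using (∙-cancelʳ)
  open import Algebra.Properties.Group M.group using (⁻¹-involutive)
  open CommSemigroupProperties *-commutativeSemigroup using (interchange)
  open import Algebra.Solver.Ring.NaturalCoefficients.Default commutativeSemiring using (solve; _:+_; _:*_; _:=_)
  open import Relation.Binary.Reasoning.Setoid setoid

  ι : Character → Character
  ι = Bijection.to i

  ι-cong : ∀ {x y} → x ≃ y → ι x ≃ ι y
  ι-cong {x} {y} x≃y = mk≃ (Bijection.cong i {x} {y} (un≃ x≃y))

  open Oplus characterGroup ι ι-cong
  open Group (AbelianGroup.group characterGroup) using (_//_)

  JL JR : M.Carrier → M.Carrier → M.Carrier → Carrier
  JL α β γ = J α β * J (α ∙ β) γ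
  JR α β γ = J α (β ∙ γ) * J β γ

  left₁ left₂ left₃ right₁ right₂ right₃ : Character → Character → Character
  left₁ x y = ι x · ι y
  left₂ x y = κ x · ι y
  left₃ x y = κ y
  right₁ x y = ι x
  right₂ x y = κ x · ι y
  right₃ x y = κ x · κ y

  left-match-resp : ∀ X Y Z {d d′ e e′} → d ≃ d′ → e ≃ e′ →
                    Match X Y Z left₁ left₂ left₃ d e → Match X Y Z left₁ left₂ left₃ d′ e′
  left-match-resp X Y Z d≃d′ e≃e′ (m₁ , m₂ , m₃) =
      ≃-trans (·-cong (ι-cong (≃-sym d≃d′)) (ι-cong (≃-sym e≃e′))) m₁
    , ≃-trans (·-cong (κ-cong (≃-sym d≃d′)) (ι-cong (≃-sym e≃e′))) m₂
    , ≃-trans (κ-cong (≃-sym e≃e′)) m₃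

  module _ (m*J≈ : ∀ α β → m * J α β ≈ ∑ M̂ (λ x → χ (ι x) α * χ (κ x) β)) where

    m*J-antidiagonal : ∀ α → m * J α (α ⁻¹) ≈ ∑ M̂ (λ x → χ x α)
    m*J-antidiagonal α = trans (m*J≈ α (α ⁻¹)) (∑-cong M̂ λ x → begin
      χ (ι x) α * (χ (ι x) (α ⁻¹) * χ x (α ⁻¹ ⁻¹))   ≈⟨ *-assoc _ _ _ ⟨
      χ (ι x) α * χ (ι x) (α ⁻¹) * χ x (α ⁻¹ ⁻¹)     ≈⟨ *-cong (χ-inverse (ι x) α) (reflexive (≡.cong (χ x) (⁻¹-involutive α))) ⟩
      1# * χ x α                                      ≈⟨ *-identityˡ _ ⟩
      χ x α                                           ∎)

    transform-J-antidiagonal : ∀ r → transform (λ α → J α (α ⁻¹)) r ≈ transform δ r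
    transform-J-antidiagonal r = trans (*-cancelˡ-≉0 m≉0 (begin
      m * transform (λ α → J α (α ⁻¹)) r       ≈⟨ *-distribˡ-∑ M.elements m _ ⟩
      ΣM (λ α → m * (J α (α ⁻¹) * χ r α))      ≈⟨ ∑-cong M.elements (λ α → trans (sym (*-assoc _ _ _)) (*-congʳ (m*J-antidiagonal α))) ⟩
      ΣM (λ α → ∑ M̂ (λ x → χ x α) * χ r α)    ≈⟨ ∑-cong M.elements (λ α → *-distribʳ-∑ M̂ (χ r α) (λ x → χ x α)) ⟩
      ΣM (λ α → ∑ M̂ (λ x → χ (x · r) α))     ≈⟨ ∑-comm M.elements M̂ _ ⟩
      ∑ M̂ (λ x → Δ (x · r))                   ≈⟨ ∑-Δ-·≈m r ⟩
      m                                       ≈⟨ *-identityʳ m ⟨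
      m * 1#                                  ∎))
      (sym (trans (∑-δ (χ r)) (unit r)))

    m²JL≈Φ : ∀ α β γ → m * m * JL α β γ ≈ Φ left₁ left₂ left₃ α β γ
    m²JL≈Φ α β γ = begin
      m * m * (J α β * J (α ∙ β) γ)     ≈⟨ interchange m m (J α β) _ ⟩
      m * J α β * (m * J (α ∙ β) γ)     ≈⟨ *-cong (m*J≈ α β) (m*J≈ (α ∙ β) γ) ⟩
      ∑ M̂ (λ x → χ (ι x) α * χ (κ x) β) * ∑ M̂ (λ y → χ (ι y) (α ∙ β) * χ (κ y) γ)
                                        ≈⟨ ∑-product M̂ M̂ _ _ ⟩
      ∑ M̂ (λ x → ∑ M̂ λ y → χ (ι x) α * χ (κ x) β * (χ (ι y) (α ∙ β) * χ (κ y) γ))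
        ≈⟨ ∑-cong M̂ (λ x → ∑-cong M̂ λ y → trans (*-congˡ (*-congʳ (hom (ι y) α β)))
             (solve 5 (λ a b c d e → a :* b :* (c :* d :* e) := a :* c :* (b :* d :* e)) refl
                    (χ (ι x) α) (χ (κ x) β) (χ (ι y) α) (χ (ι y) β) (χ (κ y) γ))) ⟩
      Φ left₁ left₂ left₃ α β γ         ∎

    m²JR≈Φ : ∀ α β γ → m * m * JR α β γ ≈ Φ right₁ right₂ right₃ α β γ
    m²JR≈Φ α β γ = begin
      m * m * (J α (β ∙ γ) * J β γ)     ≈⟨ interchange m m (J α (β ∙ γ)) _ ⟩
      m * J α (β ∙ γ) * (m * J β γ)     ≈⟨ *-cong (m*J≈ α (β ∙ γ)) (m*J≈ β γ) ⟩
      ∑ M̂ (λ x → χ (ι x) α * χ (κ x) (β ∙ γ)) * ∑ M̂ (λ y → χ (ι y) β * χ (κ y) γ)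
                                        ≈⟨ ∑-product M̂ M̂ _ _ ⟩
      ∑ M̂ (λ x → ∑ M̂ λ y → χ (ι x) α * χ (κ x) (β ∙ γ) * (χ (ι y) β * χ (κ y) γ))
        ≈⟨ ∑-cong M̂ (λ x → ∑-cong M̂ λ y → trans (*-congʳ (*-congˡ (hom (κ x) β γ)))
             (solve 5 (λ a b₁ b₂ c e → a :* (b₁ :* b₂) :* (c :* e) := a :* (b₁ :* c :* (b₂ :* e))) refl
                    (χ (ι x) α) (χ (κ x) β) (χ (κ x) γ) (χ (ι y) β) (χ (κ y) γ))) ⟩
      Φ right₁ right₂ right₃ α β γ      ∎

    module _ (cocycle : ∀ α β γ → J* α β * J* (α ∙ β) γ ≈ J* α (β ∙ γ) * J* β γ) where

      transform₃-JL≈JR : ∀ A B C → transform₃ JL A B C ≈ transform₃ JR A B C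
      transform₃-JL≈JR A B C = ∙-cancelʳ (p + q) _ _ (begin
        T JL + (p + q)
          ≈⟨ +-congˡ (+-cong (transform₃-δ₁₂ δ) (trans (transform₃-δ₂₃ J-anti) (*-congˡ (transform-J-antidiagonal (B / C))))) ⟨
        T JL + (T (λ α β γ → δ (α ∙ β) * δ α) + T (λ α β γ → δ (β ∙ γ) * J-anti β))
          ≈⟨ transform₃-+-+ JL (λ α β γ → δ (α ∙ β) * δ α) (λ α β γ → δ (β ∙ γ) * J-anti β) ⟨
        T (λ α β γ → JL α β γ + (δ (α ∙ β) * δ α + δ (β ∙ γ) * J-anti β))
          ≈⟨ transform₃-cong (cocycle-defect cocycle) ⟩
        T (λ α β γ → JR α β γ + (δ (α ∙ β) * J-anti α + δ (β ∙ γ) * δ β))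
          ≈⟨ transform₃-+-+ JR (λ α β γ → δ (α ∙ β) * J-anti α) (λ α β γ → δ (β ∙ γ) * δ β) ⟩
        T JR + (T (λ α β γ → δ (α ∙ β) * J-anti α) + T (λ α β γ → δ (β ∙ γ) * δ β))
          ≈⟨ +-congˡ (+-cong (trans (transform₃-δ₁₂ J-anti) (*-congʳ (transform-J-antidiagonal (A / B)))) (transform₃-δ₂₃ δ)) ⟩
        T JR + (p + q)  ∎)
        where
        open Transform₃ A B C
        T = λ f → transform₃ f A B C
        J-anti : M.Carrier → Carrier
        J-anti α = J α (α ⁻¹)
        p = transform δ (A / B) * Δ C
        q = Δ A * transform δ (B / C)
        transform₃-+-+ : ∀ f g h → T (λ α β γ → f α β γ + (g α β γ + h α β γ)) ≈ T f + (T g + T h)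
        transform₃-+-+ f g h = trans (transform₃-+ f _) (+-congˡ (transform₃-+ g h))

      count-left≈count-right : ∀ X Y Z → count X Y Z left₁ left₂ left₃ ≈ count X Y Z right₁ right₂ right₃
      count-left≈count-right X Y Z = begin
        count X Y Z left₁ left₂ left₃                        ≈⟨ transform₃-Φ X Y Z left₁ left₂ left₃ ⟨
        T (Φ left₁ left₂ left₃)                              ≈⟨ transform₃-cong m²JL≈Φ ⟨
        T (λ α β γ → m * m * JL α β γ)                       ≈⟨ transform₃-*ˡ (m * m) JL ⟩
        m * m * T JL                                         ≈⟨ *-congˡ (transform₃-JL≈JR (X ⁻¹ᶜ) (Y ⁻¹ᶜ) (Z ⁻¹ᶜ)) ⟩
        m * m * T JR                                         ≈⟨ transform₃-*ˡ (m * m) JR ⟨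
        T (λ α β γ → m * m * JR α β γ)                       ≈⟨ transform₃-cong m²JR≈Φ ⟩
        T (Φ right₁ right₂ right₃)                           ≈⟨ transform₃-Φ X Y Z right₁ right₂ right₃ ⟩
        count X Y Z right₁ right₂ right₃                     ∎
        where
        open Transform₃ (X ⁻¹ᶜ) (Y ⁻¹ᶜ) (Z ⁻¹ᶜ)
        T = λ f → transform₃ f (X ⁻¹ᶜ) (Y ⁻¹ᶜ) (Z ⁻¹ᶜ)

      ⊕-assoc : ∀ x y z → (x ⊕ y) ⊕ z ≃ x ⊕ (y ⊕ z)
      ⊕-assoc x y z = ≃-sym (right-triple⇒assoc (count-≉0⇒match X Y Z right₁ right₂ right₃ right-count≉0))
        where
        -- Characters are records with proof fields: writing _//_ (as in Oplus) and passing
        -- implicit arguments explicitly avoids conversion checks that unfold them.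
        w X Y Z d e : Character
        w = (x ⊕ y) ⊕ z
        X = x // w
        Y = y // w
        Z = z // w
        d = x // y
        e = (x ⊕ y) // z
        LeftMatch RightMatch : Character → Character → Set ℓ
        LeftMatch = Match X Y Z left₁ left₂ left₃
        RightMatch = Match X Y Z right₁ right₂ right₃
        left-triple : LeftMatch d e
        left-triple = ⊕-left-triple₁ x y z , ⊕-left-triple₂ x y z , ⊕-left-triple₃ x y z
        left-match : Any (λ d → Any (LeftMatch d) M̂) M̂
        left-match = any-M̂ {P = λ d → Any (LeftMatch d) M̂} (λ d≃d′ → Any.map (left-match-resp X Y Z d≃d′ ≃-refl)) {d}
                       (any-M̂ {P = LeftMatch d} (left-match-resp X Y Z ≃-refl) {e} left-triple)
        right-count≉0 : ¬ count X Y Z right₁ right₂ right₃ ≈ 0#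
        right-count≉0 count≈0 =
          count-≉0 X Y Z left₁ left₂ left₃ left-match (trans (count-left≈count-right X Y Z) count≈0)
        right-triple⇒assoc : ∃₂ RightMatch → x ⊕ (y ⊕ z) ≃ w
        right-triple⇒assoc (d′ , e′ , h₁ , h₂ , h₃) = ⊕-assoc-from-right-triple {x} {y} {z} {w} {d′} {e′} h₁ h₂ h₃

lemma6p5 : {c ℓ : Level} (M : FiniteAbelianGroup) (K : ACF0 c ℓ)
           (D : Dual.DualEnumeration M K)
           (J : FiniteAbelianGroup.Carrier M → FiniteAbelianGroup.Carrier M → ACF0.Carrier K)
           → Dual.IsJacobi M K J
           → (i : Bijection (Dual.CharSetoid M K) (Dual.CharSetoid M K))
           → (∀ x → Dual._≈ᶜ_ M K (Bijection.to i x)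
                      (Dual._·_ M K x (Bijection.to i (Dual._⁻¹ᶜ M K x))))
           → (∀ α β → ACF0._≈_ K
                (ACF0._*_ K (ACF0.fromℕ K (FiniteAbelianGroup.order M)) (J α β))
                (Dual.ΣM̂ M K D (λ x → ACF0._*_ K
                   (Dual.⟨_,_⟩ M K α (Bijection.to i x))
                   (Dual.⟨_,_⟩ M K β (Dual._/_ M K (Bijection.to i x) x)))))
           → ∀ x y z → Dual._≈ᶜ_ M K
                (Dual.⊕[_] M K i (Dual.⊕[_] M K i x y) z)
                (Dual.⊕[_] M K i x (Dual.⊕[_] M K i y z))
lemma6p5 M K D J isJacobi i _ m*J≈ x y z =
  un≃ (⊕-assoc m*J≈ (IsJacobi.cocycle isJacobi) x y z)
  where
  open Associativity M K D i J
  open Characters M K using (un≃)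
  open Dual M K using (module IsJacobi)
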